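{- Let $m_0, n_0, \ell_0$ be integers with $m_0 \ge 2$, $n_0 \ge 1$, $0 \le \ell_0 < 4n_0$ and $8n_0 \mid (m_0n_0+\ell_0-1)(m_0n_0+\ell_0+3)$. Then the graph $\mathcal{X}_a(2m_0, 8m_0n_0, 2m_0n_0+1, 2m_0\ell_0)$ admits an automorphism fixing the vertex $u_{0,0}$ and interchanging the vertices $u_{0,1}$ and $u_{1,0}$.
   Context: For $m$ even, $n$ even, $\ell\in\mathbb{Z}_n$ even and $k\in\mathbb{Z}_n$ odd, $\mathcal{X}_a(m,n,k,\ell)$ is the graph with vertices $u_{i,j}$ ($i\in\mathbb{Z}_m$, $j\in\mathbb{Z}_n$) and edges: $u_{i,j}u_{i,j+1}$ for even $i$ and $u_{i,j}u_{i,j+k}$ for odd $i$ (all $j$); $u_{i,j}u_{i+1,j}$ for integers $0\le i\le m-2$ and $j\equiv i\pmod 2$; $u_{m-1,j}u_{0,j+\ell}$ for odd $j$. -}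

module Defs where

open import Data.Nat using (ℕ; zero; suc; _+_; _*_; _∸_; _<_; _%_)
open import Data.Fin using (Fin; toℕ)
open import Data.Product using (Σ; _×_; _,_; proj₁; proj₂)
open import Data.Sum using (_⊎_)
open import Relation.Binary.PropositionalEquality using (_≡_)
open import Function.Bundles using (Inverse; _↔_)
open import Level using (0ℓ)

-- congruence of natural numbers modulo n (no NonZero needed)
_≡_[mod_] : ℕ → ℕ → ℕ → Set
a ≡ b [mod n ] = Σ ℕ λ q → (a ≡ b + q * n) ⊎ (b ≡ a + q * n)

Vertex : ℕ → ℕ → Set
Vertex m n = Fin m × Fin n

data Edge (m n k ℓ : ℕ) : Vertex m n → Vertex m n → Set where
  rowEven : ∀ i j j' → toℕ i % 2 ≡ 0 → toℕ j' ≡ toℕ j + 1 [mod n ] →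
            Edge m n k ℓ (i , j) (i , j')
  rowOdd  : ∀ i j j' → toℕ i % 2 ≡ 1 → toℕ j' ≡ toℕ j + k [mod n ] →
            Edge m n k ℓ (i , j) (i , j')
  vert    : ∀ i i' j → toℕ i' ≡ suc (toℕ i) → toℕ j % 2 ≡ toℕ i % 2 →
            Edge m n k ℓ (i , j) (i' , j)
  wrap    : ∀ i i' j j' → suc (toℕ i) ≡ m → toℕ i' ≡ 0 → toℕ j % 2 ≡ 1 →
            toℕ j' ≡ toℕ j + ℓ [mod n ] →
            Edge m n k ℓ (i , j) (i' , j')

Adj : (m n k ℓ : ℕ) → Vertex m n → Vertex m n → Set
Adj m n k ℓ u v = Edge m n k ℓ u v ⊎ Edge m n k ℓ v u

record Automorphism (m n k ℓ : ℕ) : Set where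
  field
    bij       : Vertex m n ↔ Vertex m n
  open Inverse bij public using (to; from)
  field
    preserves : ∀ u v → Adj m n k ℓ u v → Adj m n k ℓ (to u) (to v)
    reflects  : ∀ u v → Adj m n k ℓ (to u) (to v) → Adj m n k ℓ u v

-- X_a(m, n, k, ℓ) is the quotient of a periodic graph on ℤ × ℤ, in which row i is a line with
-- steps 1 or k as i is even or odd and (i , j) is joined to (i + 1 , j) when j ≡ i (mod 2), by the
-- lattice spanned by (m , −ℓ) and (0 , n).  Write a point as (2a + e , 4g + 2b + f + 2(a + ef)(m₀n₀ + 1))
-- with bits e, f, b.  Exchanging a and g, after permuting the eight bit patterns and adding small
-- corrections, sends every step of the periodic graph to a step, up to a period.  The divisibility
-- hypothesis amounts exactly to z = (m₀n₀ + ℓ₀ + 1)/2 being odd with z² ≡ 1 (mod 2n₀), and this makes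
-- the lattice invariant under the exchange.  So the exchange descends to an involutive automorphism
-- of the quotient; it fixes u₀₀ and exchanges u₀₁ and u₁₀.
module Submission where

open import Defs
open import Data.Empty using (⊥-elim)
open import Data.Fin using (Fin; zero; suc; toℕ; fromℕ<)
open import Data.Fin.Properties using (toℕ-fromℕ<; fromℕ<-cong; toℕ-injective; toℕ<n)
open import Data.List using (_∷_; [])
open import Data.Nat.Base as ℕ using (ℕ)
import Data.Nat.Properties as ℕₚ
open import Data.Nat.DivMod using (m%n<n; m<n⇒m%n≡m; m<n⇒m/n≡0; [m+kn]%n≡m%n)
open import Data.Nat.Divisibility using (_∣_; divides; ∣-trans; m∣m*n; ∣m+n∣m⇒∣n; *-cancelˡ-∣)
open import Data.Nat.Primality using (Prime; prime?; euclidsLemma)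
open import Relation.Nullary.Decidable using (from-yes)
open import Data.Product using (Σ; _×_; _,_; ∃; ∃₂; proj₁; proj₂)
open import Data.Sum using (_⊎_; inj₁; inj₂) renaming (swap to ⊎-swap)
open import Function.Bundles using (mk↔ₛ′)
open import Relation.Binary.PropositionalEquality

involution⇒automorphism : ∀ {m n k ℓ} (φ : Vertex m n → Vertex m n) → (∀ u → φ (φ u) ≡ u) →
                          (∀ u v → Edge m n k ℓ u v → Adj m n k ℓ (φ u) (φ v)) → Automorphism m n k ℓ
involution⇒automorphism {m} {n} {k} {ℓ} φ φ∘φ edge = record
  { bij = mk↔ₛ′ φ φ φ∘φ φ∘φ ; preserves = preserves ; reflects = reflects }
  where
  preserves : ∀ u v → Adj m n k ℓ u v → Adj m n k ℓ (φ u) (φ v)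
  preserves u v (inj₁ uv) = edge u v uv
  preserves u v (inj₂ vu) = ⊎-swap (edge v u vu)
  reflects : ∀ u v → Adj m n k ℓ (φ u) (φ v) → Adj m n k ℓ u v
  reflects u v adj = subst₂ (Adj m n k ℓ) (φ∘φ u) (φ∘φ v) (preserves (φ u) (φ v) adj)

FixesOriginSwapsNeighbours : ∀ {m n k ℓ} → Automorphism m n k ℓ → Set
FixesOriginSwapsNeighbours {m} {n} φ = ∀ (u v w : Vertex m n) →
  toℕ (proj₁ u) ≡ 0 → toℕ (proj₂ u) ≡ 0 →
  toℕ (proj₁ v) ≡ 0 → toℕ (proj₂ v) ≡ 1 →
  toℕ (proj₁ w) ≡ 1 → toℕ (proj₂ w) ≡ 0 →
  (Automorphism.to φ u ≡ u) × (Automorphism.to φ v ≡ w) × (Automorphism.to φ w ≡ v)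

-- Euclidean division on ℤ

module _ where
  open import Data.Integer using (ℤ; +_; -[1+_]; +[1+_]; _+_; _-_; -_; _*_; 0ℤ; 1ℤ; -1ℤ; _%ℕ_; _/ℕ_)
  open import Data.Integer.Properties using (pos-+; pos-*; +-injective; +-identityʳ; +-0-abelianGroup)
  open import Data.Integer.DivMod using (n%ℕd<d; a≡a%ℕn+[a/ℕn]*n)
  open import Data.Integer.Tactic.RingSolver using (solve)
  open import Algebra.Properties.AbelianGroup +-0-abelianGroup using () renaming (∙-cancelʳ to +-cancelʳ)
  open ≡-Reasoning

  offset-cancel : ∀ x y t u e → x + t * e ≡ y + u * e → y ≡ x + (t - u) * e
  offset-cancel x y t u e eq = begin
    y                     ≡⟨ solve (y ∷ u ∷ e ∷ []) ⟩
    y + u * e - u * e     ≡⟨ cong (_- u * e) eq ⟨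
    x + t * e - u * e     ≡⟨ solve (x ∷ t ∷ u ∷ e ∷ []) ⟩
    x + (t - u) * e       ∎

  offset-sym : ∀ x y t e → x ≡ y + t * e → y ≡ x + (- t) * e
  offset-sym x y t e eq = begin
    y                     ≡⟨ solve (y ∷ t ∷ e ∷ []) ⟩
    y + t * e + - t * e   ≡⟨ cong (_+ - t * e) eq ⟨
    x + (- t) * e         ∎

  pos-linear : ∀ r q d → + r + + q * + d ≡ + (r ℕ.+ q ℕ.* d)
  pos-linear r q d = trans (cong (_+_ (+ r)) (sym (pos-* q d))) (sym (pos-+ r (q ℕ.* d)))

  remainder-offset≡0 : ∀ {d r r′} t → r ℕ.< d → r′ ℕ.< d → + r′ ≡ + r + t * + d → t ≡ 0ℤ
  remainder-offset≡0 (+ 0) _ _ _ = refl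
  remainder-offset≡0 {d} {r} {r′} +[1+ s ] _ r′<d eq = ⊥-elim (ℕₚ.<⇒≱ r′<d d≤r′)
    where
    d≤r′ : d ℕ.≤ r′
    d≤r′ = ℕₚ.≤-trans (ℕₚ.m≤n*m d (ℕ.suc s))
             (ℕₚ.≤-trans (ℕₚ.m≤n+m _ r) (ℕₚ.≤-reflexive (+-injective (sym (trans eq (pos-linear r (ℕ.suc s) d))))))
  remainder-offset≡0 {d} {r} {r′} -[1+ s ] r<d r′<d eq
    with remainder-offset≡0 +[1+ s ] r′<d r<d (offset-sym (+ r′) (+ r) -[1+ s ] (+ d) eq)
  ... | ()

  divmod-unique : ∀ {d r r′} q q′ → r ℕ.< d → r′ ℕ.< d →
                  + r + q * + d ≡ + r′ + q′ * + d → r ≡ r′ × q ≡ q′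
  divmod-unique {d} {r} {r′} q q′ r<d r′<d eq = +-injective (sym r′≡r) , q≡q′
    where
    q-q′≡0 : q - q′ ≡ 0ℤ
    q-q′≡0 = remainder-offset≡0 (q - q′) r<d r′<d (offset-cancel (+ r) (+ r′) q q′ (+ d) eq)
    r′≡r : + r′ ≡ + r
    r′≡r = begin
      + r′                  ≡⟨ offset-cancel (+ r) (+ r′) q q′ (+ d) eq ⟩
      + r + (q - q′) * + d  ≡⟨ cong (λ t → + r + t * + d) q-q′≡0 ⟩
      + r + 0ℤ              ≡⟨ +-identityʳ (+ r) ⟩
      + r                   ∎
    q≡q′ : q ≡ q′
    q≡q′ = begin
      q             ≡⟨ solve (q ∷ q′ ∷ []) ⟩
      q′ + (q - q′) ≡⟨ cong (_+_ q′) q-q′≡0 ⟩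
      q′ + 0ℤ       ≡⟨ +-identityʳ q′ ⟩
      q′            ∎

  divmod-exact : ∀ x d .{{_ : ℕ.NonZero d}} r q → r ℕ.< d → x ≡ + r + q * + d →
                 x %ℕ d ≡ r × x /ℕ d ≡ q
  divmod-exact x d r q r<d eq = divmod-unique (x /ℕ d) q (n%ℕd<d x d) r<d (trans (sym (a≡a%ℕn+[a/ℕn]*n x d)) eq)

  2a+x≡x+a*2 : ∀ a x → + 2 * a + x ≡ x + a * + 2
  2a+x≡x+a*2 a x = solve (a ∷ x ∷ [])

  +-right-comm : ∀ a b c → a + b + c ≡ a + c + b
  +-right-comm a b c = solve (a ∷ b ∷ c ∷ [])

  add-multiple : ∀ x y q t e → x ≡ y + q * e → x + t * e ≡ y + (q + t) * e
  add-multiple x y q t e eq = begin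
    x + t * e            ≡⟨ cong (_+ t * e) eq ⟩
    y + q * e + t * e    ≡⟨ solve (y ∷ q ∷ t ∷ e ∷ []) ⟩
    y + (q + t) * e      ∎

  divmod-+-multiple : ∀ x t d .{{_ : ℕ.NonZero d}} →
                      (x + t * + d) %ℕ d ≡ x %ℕ d × (x + t * + d) /ℕ d ≡ x /ℕ d + t
  divmod-+-multiple x t d = divmod-exact _ d (x %ℕ d) (x /ℕ d + t) (n%ℕd<d x d)
    (add-multiple x (+ (x %ℕ d)) (x /ℕ d) t (+ d) (a≡a%ℕn+[a/ℕn]*n x d))

  _mod_ : ℤ → (d : ℕ) .{{_ : ℕ.NonZero d}} → Fin d
  x mod d = fromℕ< (n%ℕd<d x d)

  offset⇒≡[mod] : ∀ {a b d} t → + a ≡ + b + t * + d → a ≡ b [mod d ]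
  offset⇒≡[mod] {a} {b} {d} (+ s) eq = s , inj₁ (+-injective (trans eq (pos-linear b s d)))
  offset⇒≡[mod] {a} {b} {d} -[1+ s ] eq =
    ℕ.suc s , inj₂ (+-injective (trans (offset-sym (+ a) (+ b) -[1+ s ] (+ d) eq) (pos-linear a (ℕ.suc s) d)))

  ≡[mod]⇒offset : ∀ a b d → a ≡ b [mod d ] → ∃ λ t → + a ≡ + b + t * + d
  ≡[mod]⇒offset a b d (s , inj₁ eq) = + s , trans (cong +_ eq) (sym (pos-linear b s d))
  ≡[mod]⇒offset a b d (s , inj₂ eq) =
    - + s , offset-sym (+ b) (+ a) (+ s) (+ d) (trans (cong +_ eq) (sym (pos-linear a s d)))

  %ℕ-%-even : ∀ x d .{{_ : ℕ.NonZero d}} → 2 ∣ d → (x %ℕ d) ℕ.% 2 ≡ x %ℕ 2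
  %ℕ-%-even x d (divides q d≡q*2) = sym (proj₁ (divmod-exact x 2 (r ℕ.% 2) (+ (r ℕ./ 2) + Q * + q) (m%n<n r 2) (begin
      x                                         ≡⟨ a≡a%ℕn+[a/ℕn]*n x d ⟩
      + r + Q * + d                             ≡⟨ cong (λ t → + r + Q * t) (trans (cong +_ d≡q*2) (pos-* q 2)) ⟩
      + r + Q * (+ q * + 2)                     ≡⟨ cong (_+ Q * (+ q * + 2)) (a≡a%ℕn+[a/ℕn]*n (+ r) 2) ⟩
      + (r ℕ.% 2) + + (r ℕ./ 2) * + 2 + Q * (+ q * + 2)  ≡⟨ regroup (+ (r ℕ.% 2)) (+ (r ℕ./ 2)) Q (+ q) ⟩
      + (r ℕ.% 2) + (+ (r ℕ./ 2) + Q * + q) * + 2        ∎)))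
    where
    r = x %ℕ d
    Q = x /ℕ d
    regroup : ∀ a b c e → a + b * + 2 + c * (e * + 2) ≡ a + (b + c * e) * + 2
    regroup a b c e = solve (a ∷ b ∷ c ∷ e ∷ [])

  2∣1+n⇒n%2≡1 : ∀ {r} → 2 ∣ ℕ.suc r → r ℕ.% 2 ≡ 1
  2∣1+n⇒n%2≡1 (divides (ℕ.suc q) r+1≡q*2) =
    trans (cong (ℕ._% 2) (ℕₚ.suc-injective r+1≡q*2)) ([m+kn]%n≡m%n 1 q 2)

  toℕ-mod : ∀ x d .{{_ : ℕ.NonZero d}} → toℕ (x mod d) ≡ x %ℕ d
  toℕ-mod x d = toℕ-fromℕ< (n%ℕd<d x d)

  mod-cong : ∀ x y d .{{_ : ℕ.NonZero d}} → x %ℕ d ≡ y %ℕ d → x mod d ≡ y mod d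
  mod-cong x y d eq = fromℕ<-cong _ _ eq (n%ℕd<d x d) (n%ℕd<d y d)

  %ℕ-+ : ∀ x s d .{{_ : ℕ.NonZero d}} → ((x + + s) %ℕ d) ≡ (x %ℕ d ℕ.+ s) [mod d ]
  %ℕ-+ x s d = offset⇒≡[mod] (x /ℕ d - (x + + s) /ℕ d)
    (offset-cancel (+ (x %ℕ d ℕ.+ s)) (+ ((x + + s) %ℕ d)) (x /ℕ d) ((x + + s) /ℕ d) (+ d) (begin
    + (x %ℕ d ℕ.+ s) + x /ℕ d * + d   ≡⟨ cong (_+ x /ℕ d * + d) (pos-+ (x %ℕ d) s) ⟩
    + (x %ℕ d) + + s + x /ℕ d * + d   ≡⟨ +-right-comm (+ (x %ℕ d)) (+ s) (x /ℕ d * + d) ⟩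
    + (x %ℕ d) + x /ℕ d * + d + + s   ≡⟨ cong (_+ + s) (a≡a%ℕn+[a/ℕn]*n x d) ⟨
    x + + s                           ≡⟨ a≡a%ℕn+[a/ℕn]*n (x + + s) d ⟩
    + ((x + + s) %ℕ d) + (x + + s) /ℕ d * + d ∎))

  toℕ-mod-+ : ∀ x s d .{{_ : ℕ.NonZero d}} → toℕ ((x + + s) mod d) ≡ (toℕ (x mod d) ℕ.+ s) [mod d ]
  toℕ-mod-+ x s d = subst₂ (λ a b → a ≡ b [mod d ])
    (sym (toℕ-mod (x + + s) d)) (cong (ℕ._+ s) (sym (toℕ-mod x d))) (%ℕ-+ x s d)

  -- The periodic cover

  data Point : Set where
    ⟪_,_⟫ : ℤ → ℤ → Point

  row-of column-of : Point → ℤ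
  row-of    ⟪ i , j ⟫ = i
  column-of ⟪ i , j ⟫ = j

  module Cover (m n k ℓ : ℕ) .{{_ : ℕ.NonZero m}} .{{_ : ℕ.NonZero n}}
               (2∣m : 2 ∣ m) (2∣n : 2 ∣ n) (2∣ℓ : 2 ∣ ℓ) where

    -- Each time a path climbs past row m − 1 it re-enters row 0 shifted by ℓ columns.
    project : Point → Vertex m n
    project ⟪ i , j ⟫ = i mod m , (j + i /ℕ m * + ℓ) mod n

    lift : Vertex m n → Point
    lift (i , j) = ⟪ + toℕ i , + toℕ j ⟫

    translate : ℤ → ℤ → Point → Point
    translate μ ν ⟪ i , j ⟫ = ⟪ i + μ * + m , j - μ * + ℓ + ν * + n ⟫

    project-translate : ∀ μ ν x → project (translate μ ν x) ≡ project x
    project-translate μ ν ⟪ i , j ⟫ =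
      cong₂ _,_ (mod-cong (i + μ * + m) i m (proj₁ (divmod-+-multiple i μ m)))
                (mod-cong (j - μ * + ℓ + ν * + n + (i + μ * + m) /ℕ m * + ℓ) (j + i /ℕ m * + ℓ) n column)
      where
      regroup : ∀ j μ ν q L N → j - μ * L + ν * N + (q + μ) * L ≡ j + q * L + ν * N
      regroup j μ ν q L N = solve (j ∷ μ ∷ ν ∷ q ∷ L ∷ N ∷ [])
      column : (j - μ * + ℓ + ν * + n + (i + μ * + m) /ℕ m * + ℓ) %ℕ n ≡ (j + i /ℕ m * + ℓ) %ℕ n
      column = begin
        (j - μ * + ℓ + ν * + n + (i + μ * + m) /ℕ m * + ℓ) %ℕ n
          ≡⟨ cong (λ q → (j - μ * + ℓ + ν * + n + q * + ℓ) %ℕ n) (proj₂ (divmod-+-multiple i μ m)) ⟩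
        (j - μ * + ℓ + ν * + n + (i /ℕ m + μ) * + ℓ) %ℕ n
          ≡⟨ cong (_%ℕ n) (regroup j μ ν (i /ℕ m) (+ ℓ) (+ n)) ⟩
        (j + i /ℕ m * + ℓ + ν * + n) %ℕ n
          ≡⟨ proj₁ (divmod-+-multiple (j + i /ℕ m * + ℓ) ν n) ⟩
        (j + i /ℕ m * + ℓ) %ℕ n
          ∎

    project-lift : ∀ u → project (lift u) ≡ u
    project-lift (i , j) =
      cong₂ _,_ (toℕ-injective (trans (toℕ-mod (+ toℕ i) m) (m<n⇒m%n≡m (toℕ<n i))))
                (toℕ-injective (trans (toℕ-mod (+ toℕ j + + (toℕ i ℕ./ m) * + ℓ) n) column))
      where
      column : (+ toℕ j + + (toℕ i ℕ./ m) * + ℓ) %ℕ n ≡ toℕ j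
      column rewrite m<n⇒m/n≡0 (toℕ<n i) =
        trans (cong (ℕ._% n) (ℕₚ.+-identityʳ (toℕ j))) (m<n⇒m%n≡m (toℕ<n j))

    lift-project : ∀ x → ∃₂ λ μ ν → lift (project x) ≡ translate μ ν x
    lift-project ⟪ i , j ⟫ = - (i /ℕ m) , - (X /ℕ n) , cong₂ ⟪_,_⟫ row column
      where
      X = j + i /ℕ m * + ℓ
      regroup : ∀ j q L c → j + q * L + c ≡ j - - q * L + c
      regroup j q L c = solve (j ∷ q ∷ L ∷ c ∷ [])
      row : + toℕ (i mod m) ≡ i + - (i /ℕ m) * + m
      row = trans (cong +_ (toℕ-mod i m)) (offset-sym i (+ (i %ℕ m)) (i /ℕ m) (+ m) (a≡a%ℕn+[a/ℕn]*n i m))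
      column : + toℕ (X mod n) ≡ j - - (i /ℕ m) * + ℓ + - (X /ℕ n) * + n
      column = begin
        + toℕ (X mod n)                            ≡⟨ cong +_ (toℕ-mod X n) ⟩
        + (X %ℕ n)                                 ≡⟨ offset-sym X (+ (X %ℕ n)) (X /ℕ n) (+ n) (a≡a%ℕn+[a/ℕn]*n X n) ⟩
        X + - (X /ℕ n) * + n                       ≡⟨ regroup j (i /ℕ m) (+ ℓ) (- (X /ℕ n) * + n) ⟩
        j - - (i /ℕ m) * + ℓ + - (X /ℕ n) * + n    ∎

    translate⇒project≡ : ∀ x {v} μ ν → lift v ≡ translate μ ν x → project x ≡ v
    translate⇒project≡ x {v} μ ν eq = begin
      project x                   ≡⟨ project-translate μ ν x ⟨
      project (translate μ ν x)   ≡⟨ cong project eq ⟨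
      project (lift v)            ≡⟨ project-lift v ⟩
      v                           ∎

    row-parity : ∀ i → toℕ (i mod m) ℕ.% 2 ≡ i %ℕ 2
    row-parity i = trans (cong (ℕ._% 2) (toℕ-mod i m)) (%ℕ-%-even i m 2∣m)

    column-parity : ∀ i j → toℕ ((j + i /ℕ m * + ℓ) mod n) ℕ.% 2 ≡ j %ℕ 2
    column-parity i j = begin
      toℕ (X mod n) ℕ.% 2           ≡⟨ cong (ℕ._% 2) (toℕ-mod X n) ⟩
      (X %ℕ n) ℕ.% 2                ≡⟨ %ℕ-%-even X n 2∣n ⟩
      X %ℕ 2                        ≡⟨ cong (_%ℕ 2) X≡ ⟩
      (j + i /ℕ m * + ℓ′ * + 2) %ℕ 2 ≡⟨ proj₁ (divmod-+-multiple j (i /ℕ m * + ℓ′) 2) ⟩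
      j %ℕ 2                        ∎
      where
      X = j + i /ℕ m * + ℓ
      open _∣_ 2∣ℓ renaming (quotient to ℓ′; equality to ℓ≡ℓ′*2)
      regroup : ∀ j q L → j + q * (L * + 2) ≡ j + q * L * + 2
      regroup j q L = solve (j ∷ q ∷ L ∷ [])
      X≡ : X ≡ j + i /ℕ m * + ℓ′ * + 2
      X≡ = trans (cong (λ L → j + i /ℕ m * L) (trans (cong +_ ℓ≡ℓ′*2) (pos-* ℓ′ 2))) (regroup j (i /ℕ m) (+ ℓ′))

    last-row-odd : ∀ r → ℕ.suc r ≡ m → r ℕ.% 2 ≡ 1
    last-row-odd r r+1≡m = 2∣1+n⇒n%2≡1 (subst (2 ∣_) (sym r+1≡m) 2∣m)

    column-step : ∀ i j s → toℕ ((j + + s + i /ℕ m * + ℓ) mod n) ≡ (toℕ ((j + i /ℕ m * + ℓ) mod n) ℕ.+ s) [mod n ]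
    column-step i j s = subst (λ y → toℕ (y mod n) ≡ (toℕ ((j + i /ℕ m * + ℓ) mod n) ℕ.+ s) [mod n ])
      (+-right-comm j (i /ℕ m * + ℓ) (+ s)) (toℕ-mod-+ (j + i /ℕ m * + ℓ) s n)

    stride : Fin 2 → ℕ
    stride zero       = 1
    stride (suc zero) = k

    along-edge : ∀ e i j → i %ℕ 2 ≡ toℕ e → Edge m n k ℓ (project ⟪ i , j ⟫) (project ⟪ i , j + + stride e ⟫)
    along-edge zero       i j i-even = rowEven _ _ _ (trans (row-parity i) i-even) (column-step i j 1)
    along-edge (suc zero) i j i-odd  = rowOdd _ _ _ (trans (row-parity i) i-odd) (column-step i j k)

    up-edge : ∀ i j → i %ℕ 2 ≡ j %ℕ 2 → Edge m n k ℓ (project ⟪ i , j ⟫) (project ⟪ i + 1ℤ , j ⟫)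
    up-edge i j i≡j = climb (ℕₚ.m≤n⇒m<n∨m≡n (n%ℕd<d i m))
      where
      r = i %ℕ m
      q = i /ℕ m
      X = j + q * + ℓ
      i+1≡ : i + 1ℤ ≡ + ℕ.suc r + q * + m
      i+1≡ = trans (cong (_+ 1ℤ) (a≡a%ℕn+[a/ℕn]*n i m)) (regroup (+ r) (q * + m))
        where
        regroup : ∀ a b → a + b + 1ℤ ≡ 1ℤ + a + b
        regroup a b = solve (a ∷ b ∷ [])
      column≡row : toℕ (X mod n) ℕ.% 2 ≡ toℕ (i mod m) ℕ.% 2
      column≡row = trans (column-parity i j) (trans (sym i≡j) (sym (row-parity i)))
      climb : ℕ.suc r ℕ.< m ⊎ ℕ.suc r ≡ m → Edge m n k ℓ (project ⟪ i , j ⟫) (project ⟪ i + 1ℤ , j ⟫)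
      climb (inj₁ r+1<m) = subst (λ q′ → Edge m n k ℓ (project ⟪ i , j ⟫) ((i + 1ℤ) mod m , (j + q′ * + ℓ) mod n))
        (sym (proj₂ i+1-divided))
        (vert _ _ _ (trans (toℕ-mod (i + 1ℤ) m) (trans (proj₁ i+1-divided) (cong ℕ.suc (sym (toℕ-mod i m))))) column≡row)
        where
        i+1-divided = divmod-exact (i + 1ℤ) m (ℕ.suc r) q r+1<m i+1≡
      climb (inj₂ r+1≡m) = wrap _ _ _ _
        (trans (cong ℕ.suc (toℕ-mod i m)) r+1≡m)
        (trans (toℕ-mod (i + 1ℤ) m) (proj₁ i+1-divided))
        (trans column≡row (trans (cong (ℕ._% 2) (toℕ-mod i m)) (last-row-odd r r+1≡m)))
        (subst (λ y → toℕ (y mod n) ≡ (toℕ (X mod n) ℕ.+ ℓ) [mod n ]) X+ℓ≡ (toℕ-mod-+ X ℓ n))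
        where
        regroup : ∀ M q → M + q * M ≡ 0ℤ + (q + 1ℤ) * M
        regroup M q = solve (M ∷ q ∷ [])
        i+1-divided = divmod-exact (i + 1ℤ) m 0 (q + 1ℤ) (ℕₚ.≤-trans (ℕ.s≤s ℕ.z≤n) (n%ℕd<d i m))
                 (trans i+1≡ (trans (cong (λ M → M + q * + m) (cong +_ r+1≡m)) (regroup (+ m) q)))
        regroup′ : ∀ j q L → j + q * L + L ≡ j + (q + 1ℤ) * L
        regroup′ j q L = solve (j ∷ q ∷ L ∷ [])
        X+ℓ≡ : X + + ℓ ≡ j + (i + 1ℤ) /ℕ m * + ℓ
        X+ℓ≡ = trans (regroup′ j q (+ ℓ)) (cong (λ q′ → j + q′ * + ℓ) (sym (proj₂ i+1-divided)))

    row-lift : ∀ (i : Fin m) (j j′ : Fin n) s → toℕ j′ ≡ (toℕ j ℕ.+ s) [mod n ] →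
               project ⟪ + toℕ i , + toℕ j + + s ⟫ ≡ (i , j′)
    row-lift i j j′ s j′≡ =
      translate⇒project≡ ⟪ + toℕ i , + toℕ j + + s ⟫ 0ℤ t (cong₂ ⟪_,_⟫ (sym (+-identityʳ (+ toℕ i))) column)
      where
      t = proj₁ (≡[mod]⇒offset (toℕ j′) (toℕ j ℕ.+ s) n j′≡)
      regroup : ∀ J S L T N → J + S + T * N ≡ J + S - 0ℤ * L + T * N
      regroup J S L T N = solve (J ∷ S ∷ L ∷ T ∷ N ∷ [])
      column : + toℕ j′ ≡ + toℕ j + + s - 0ℤ * + ℓ + t * + n
      column = begin
        + toℕ j′                             ≡⟨ proj₂ (≡[mod]⇒offset (toℕ j′) (toℕ j ℕ.+ s) n j′≡) ⟩
        + (toℕ j ℕ.+ s) + t * + n            ≡⟨ cong (_+ t * + n) (pos-+ (toℕ j) s) ⟩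
        + toℕ j + + s + t * + n              ≡⟨ regroup (+ toℕ j) (+ s) (+ ℓ) t (+ n) ⟩
        + toℕ j + + s - 0ℤ * + ℓ + t * + n   ∎

    vert-lift : ∀ (i i′ : Fin m) (j : Fin n) → toℕ i′ ≡ ℕ.suc (toℕ i) → project ⟪ + toℕ i + 1ℤ , + toℕ j ⟫ ≡ (i′ , j)
    vert-lift i i′ j i′≡ = trans (cong (λ x → project ⟪ x , + toℕ j ⟫) row) (project-lift (i′ , j))
      where
      row : + toℕ i + 1ℤ ≡ + toℕ i′
      row = cong +_ (trans (ℕₚ.+-comm (toℕ i) 1) (sym i′≡))

    wrap-lift : ∀ (i i′ : Fin m) (j j′ : Fin n) → ℕ.suc (toℕ i) ≡ m → toℕ i′ ≡ 0 → toℕ j′ ≡ (toℕ j ℕ.+ ℓ) [mod n ] →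
                project ⟪ + toℕ i + 1ℤ , + toℕ j ⟫ ≡ (i′ , j′)
    wrap-lift i i′ j j′ i+1≡m i′≡0 j′≡ = translate⇒project≡ ⟪ + toℕ i + 1ℤ , + toℕ j ⟫ -1ℤ t (cong₂ ⟪_,_⟫ row column)
      where
      t = proj₁ (≡[mod]⇒offset (toℕ j′) (toℕ j ℕ.+ ℓ) n j′≡)
      cancel : ∀ M → 0ℤ ≡ M + -1ℤ * M
      cancel M = solve (M ∷ [])
      regroup : ∀ J L T N → J + L + T * N ≡ J - -1ℤ * L + T * N
      regroup J L T N = solve (J ∷ L ∷ T ∷ N ∷ [])
      row : + toℕ i′ ≡ + toℕ i + 1ℤ + -1ℤ * + m
      row = begin
        + toℕ i′                   ≡⟨ cong +_ i′≡0 ⟩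
        0ℤ                         ≡⟨ cancel (+ m) ⟩
        + m + -1ℤ * + m            ≡⟨ cong (λ x → + x + -1ℤ * + m) (trans (sym i+1≡m) (ℕₚ.+-comm 1 (toℕ i))) ⟩
        + toℕ i + 1ℤ + -1ℤ * + m   ∎
      column : + toℕ j′ ≡ + toℕ j - -1ℤ * + ℓ + t * + n
      column = begin
        + toℕ j′                          ≡⟨ proj₂ (≡[mod]⇒offset (toℕ j′) (toℕ j ℕ.+ ℓ) n j′≡) ⟩
        + (toℕ j ℕ.+ ℓ) + t * + n         ≡⟨ cong (_+ t * + n) (pos-+ (toℕ j) ℓ) ⟩
        + toℕ j + + ℓ + t * + n           ≡⟨ regroup (+ toℕ j) (+ ℓ) t (+ n) ⟩
        + toℕ j - -1ℤ * + ℓ + t * + n     ∎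

  -- Coordinates in which the automorphism is a transposition

  -- M and N stand for m₀ and n₀, and Z for the odd number z = (m₀n₀ + ℓ₀ + 1)/2.
  module Swap (m n k ℓ : ℕ) .{{_ : ℕ.NonZero m}} .{{_ : ℕ.NonZero n}}
              (2∣m : 2 ∣ m) (2∣n : 2 ∣ n) (2∣ℓ : 2 ∣ ℓ) (M N Z Y W : ℤ)
              (m≡ : + m ≡ + 2 * M) (n≡ : + n ≡ + 8 * M * N) (k≡ : + k ≡ + 2 * M * N + 1ℤ)
              (ℓ≡ : + ℓ ≡ + 2 * M * (+ 2 * Z - M * N - 1ℤ))
              (Z≡ : Z ≡ + 2 * Y + 1ℤ) (Z²≡ : Z * Z ≡ 1ℤ + + 2 * N * W) where

    open Cover m n k ℓ 2∣m 2∣n 2∣ℓ public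

    -- (e , f , b): e and f are the parities of row and column, b tells apart the two columns
    -- of parity f in a block of four.  In E0 … O3 the letter gives e and the digit is f + 2b.
    Class : Set
    Class = Fin 2 × Fin 2 × Fin 2

    pattern E0 = zero , zero , zero
    pattern E1 = zero , suc zero , zero
    pattern E2 = zero , zero , suc zero
    pattern E3 = zero , suc zero , suc zero
    pattern O0 = suc zero , zero , zero
    pattern O1 = suc zero , suc zero , zero
    pattern O2 = suc zero , zero , suc zero
    pattern O3 = suc zero , suc zero , suc zero

    data Code : Set where
      ⟨_,_,_⟩ : Class → ℤ → ℤ → Code

    ⟨,,⟩-cong : ∀ {c c′ a a′ g g′} → c ≡ c′ → a ≡ a′ → g ≡ g′ → ⟨ c , a , g ⟩ ≡ ⟨ c′ , a′ , g′ ⟩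
    ⟨,,⟩-cong refl refl refl = refl

    position : (e f b a g : ℤ) → Point
    position e f b a g = ⟪ + 2 * a + e , + 4 * g + + 2 * b + f + (a + e * f) * (+ 2 * (M * N + 1ℤ)) ⟫

    ⟦_⟧ : Fin 2 → ℤ
    ⟦ x ⟧ = + toℕ x

    decode : Code → Point
    decode ⟨ (e , f , b) , a , g ⟩ = position ⟦ e ⟧ ⟦ f ⟧ ⟦ b ⟧ a g

    vertex : Code → Vertex m n
    vertex c = project (decode c)

    shift : ℤ → ℤ → Code → Code
    shift μ ν ⟨ c , a , g ⟩ = ⟨ c , a + μ * M , g - μ * M * Z + ν * (+ 2 * M * N) ⟩

    position-shift : ∀ e f b a g μ ν →
      position e f b (a + μ * M) (g - μ * M * Z + ν * (+ 2 * M * N)) ≡ translate μ ν (position e f b a g)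
    position-shift e f b a g μ ν = cong₂ ⟪_,_⟫ row column
      where
      row : + 2 * (a + μ * M) + e ≡ + 2 * a + e + μ * + m
      row = begin
        + 2 * (a + μ * M) + e        ≡⟨ solve (a ∷ μ ∷ M ∷ e ∷ []) ⟩
        + 2 * a + e + μ * (+ 2 * M)  ≡⟨ cong (λ x → + 2 * a + e + μ * x) m≡ ⟨
        + 2 * a + e + μ * + m        ∎
      K = + 2 * (M * N + 1ℤ)
      column : + 4 * (g - μ * M * Z + ν * (+ 2 * M * N)) + + 2 * b + f + (a + μ * M + e * f) * K
             ≡ + 4 * g + + 2 * b + f + (a + e * f) * K - μ * + ℓ + ν * + n
      column = begin
        + 4 * (g - μ * M * Z + ν * (+ 2 * M * N)) + + 2 * b + f + (a + μ * M + e * f) * (+ 2 * (M * N + 1ℤ))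
          ≡⟨ solve (e ∷ f ∷ b ∷ a ∷ g ∷ μ ∷ ν ∷ M ∷ N ∷ Z ∷ []) ⟩
        + 4 * g + + 2 * b + f + (a + e * f) * (+ 2 * (M * N + 1ℤ))
          - μ * (+ 2 * M * (+ 2 * Z - M * N - 1ℤ)) + ν * (+ 8 * M * N)
          ≡⟨ cong₂ (λ x y → + 4 * g + + 2 * b + f + (a + e * f) * (+ 2 * (M * N + 1ℤ)) - μ * x + ν * y) ℓ≡ n≡ ⟨
        + 4 * g + + 2 * b + f + (a + e * f) * (+ 2 * (M * N + 1ℤ)) - μ * + ℓ + ν * + n
          ∎

    decode-shift : ∀ μ ν c → decode (shift μ ν c) ≡ translate μ ν (decode c)
    decode-shift μ ν ⟨ (e , f , b) , a , g ⟩ = position-shift ⟦ e ⟧ ⟦ f ⟧ ⟦ b ⟧ a g μ ν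

    vertex-shift : ∀ μ ν c → vertex (shift μ ν c) ≡ vertex c
    vertex-shift μ ν c = trans (cong project (decode-shift μ ν c)) (project-translate μ ν (decode c))

    column-parity-split : ∀ e f b a g → + 4 * g + + 2 * b + f + (a + e * f) * (+ 2 * (M * N + 1ℤ))
                                  ≡ f + (+ 2 * g + b + (a + e * f) * (M * N + 1ℤ)) * + 2
    column-parity-split e f b a g = solve (e ∷ f ∷ b ∷ a ∷ g ∷ M ∷ N ∷ [])

    decode-injective : ∀ c c′ → decode c ≡ decode c′ → c ≡ c′
    decode-injective ⟨ (e , f , b) , a , g ⟩ ⟨ (e′ , f′ , b′) , a′ , g′ ⟩ eq =
      ⟨,,⟩-cong (cong₂ _,_ (toℕ-injective (proj₁ row))
                           (cong₂ _,_ (toℕ-injective (proj₁ column)) (toℕ-injective (proj₁ block))))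
                (proj₂ row) (proj₂ block)
      where
      H = M * N + 1ℤ
      R = (a + ⟦ e ⟧ * ⟦ f ⟧) * H
      R′ = (a′ + ⟦ e′ ⟧ * ⟦ f′ ⟧) * H
      row = divmod-unique a a′ (toℕ<n e) (toℕ<n e′)
              (trans (sym (2a+x≡x+a*2 a ⟦ e ⟧)) (trans (cong row-of eq) (2a+x≡x+a*2 a′ ⟦ e′ ⟧)))
      column = divmod-unique (+ 2 * g + ⟦ b ⟧ + R) (+ 2 * g′ + ⟦ b′ ⟧ + R′) (toℕ<n f) (toℕ<n f′)
                 (trans (sym (column-parity-split ⟦ e ⟧ ⟦ f ⟧ ⟦ b ⟧ a g))
                   (trans (cong column-of eq) (column-parity-split ⟦ e′ ⟧ ⟦ f′ ⟧ ⟦ b′ ⟧ a′ g′)))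
      R′≡R : R′ ≡ R
      R′≡R = cong₂ (λ x y → (x + y) * H) (sym (proj₂ row))
                   (cong₂ _*_ (cong +_ (sym (proj₁ row))) (cong +_ (sym (proj₁ column))))
      block = divmod-unique g g′ (toℕ<n b) (toℕ<n b′)
                (trans (sym (2a+x≡x+a*2 g ⟦ b ⟧))
                  (trans (+-cancelʳ R (+ 2 * g + ⟦ b ⟧) (+ 2 * g′ + ⟦ b′ ⟧)
                           (trans (proj₂ column) (cong (_+_ (+ 2 * g′ + ⟦ b′ ⟧)) R′≡R)))
                    (2a+x≡x+a*2 g′ ⟦ b′ ⟧)))

    swap : Code → Code
    swap ⟨ E0 , a , g ⟩ = ⟨ E0 , g , a ⟩
    swap ⟨ E1 , a , g ⟩ = ⟨ O0 , g , a ⟩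
    swap ⟨ E2 , a , g ⟩ = ⟨ O3 , g , a - 1ℤ ⟩
    swap ⟨ E3 , a , g ⟩ = ⟨ E3 , g + 1ℤ , a - 1ℤ ⟩
    swap ⟨ O0 , a , g ⟩ = ⟨ E1 , g , a ⟩
    swap ⟨ O1 , a , g ⟩ = ⟨ O1 , g , a - M * N ⟩
    swap ⟨ O2 , a , g ⟩ = ⟨ O2 , g , a + M * N ⟩
    swap ⟨ O3 , a , g ⟩ = ⟨ E2 , g + 1ℤ , a ⟩

    -- The periods are permuted by swap; this is where Z² = 1 + 2NW is needed.
    module _ (μ ν : ℤ) where
      private
        first : ∀ g → g - μ * M * Z + ν * (+ 2 * M * N) ≡ g + (+ 2 * ν * N - μ * Z) * M
        first g = solve (g ∷ μ ∷ ν ∷ M ∷ N ∷ Z ∷ [])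
        first+ : ∀ g s → g - μ * M * Z + ν * (+ 2 * M * N) + s ≡ g + s + (+ 2 * ν * N - μ * Z) * M
        first+ g s = solve (g ∷ s ∷ μ ∷ ν ∷ M ∷ N ∷ Z ∷ [])
        second : ∀ a → a + μ * M ≡ a - (+ 2 * ν * N - μ * Z) * M * Z + (ν * Z - μ * W) * (+ 2 * M * N)
        second a = begin
          a + μ * M
            ≡⟨ solve (a ∷ μ ∷ M ∷ N ∷ W ∷ []) ⟩
          a + μ * M * (1ℤ + + 2 * N * W) - + 2 * μ * M * N * W
            ≡⟨ cong (λ z → a + μ * M * z - + 2 * μ * M * N * W) Z²≡ ⟨
          a + μ * M * (Z * Z) - + 2 * μ * M * N * W
            ≡⟨ solve (a ∷ μ ∷ ν ∷ M ∷ N ∷ Z ∷ W ∷ []) ⟩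
          a - (+ 2 * ν * N - μ * Z) * M * Z + (ν * Z - μ * W) * (+ 2 * M * N)
            ∎
        second+ : ∀ a t → a + μ * M + t ≡ a + t - (+ 2 * ν * N - μ * Z) * M * Z + (ν * Z - μ * W) * (+ 2 * M * N)
        second+ a t = trans (+-right-comm a (μ * M) t) (second (a + t))

      swap-shift : ∀ c → swap (shift μ ν c) ≡ shift (+ 2 * ν * N - μ * Z) (ν * Z - μ * W) (swap c)
      swap-shift ⟨ E0 , a , g ⟩ = cong₂ ⟨ E0 ,_,_⟩ (first g) (second a)
      swap-shift ⟨ E1 , a , g ⟩ = cong₂ ⟨ O0 ,_,_⟩ (first g) (second a)
      swap-shift ⟨ E2 , a , g ⟩ = cong₂ ⟨ O3 ,_,_⟩ (first g) (second+ a -1ℤ)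
      swap-shift ⟨ E3 , a , g ⟩ = cong₂ ⟨ E3 ,_,_⟩ (first+ g 1ℤ) (second+ a -1ℤ)
      swap-shift ⟨ O0 , a , g ⟩ = cong₂ ⟨ E1 ,_,_⟩ (first g) (second a)
      swap-shift ⟨ O1 , a , g ⟩ = cong₂ ⟨ O1 ,_,_⟩ (first g) (second+ a (- (M * N)))
      swap-shift ⟨ O2 , a , g ⟩ = cong₂ ⟨ O2 ,_,_⟩ (first g) (second+ a (M * N))
      swap-shift ⟨ O3 , a , g ⟩ = cong₂ ⟨ E2 ,_,_⟩ (first+ g 1ℤ) (second a)

    data _≈_ (c c′ : Code) : Set where
      shifted : ∀ μ ν → c′ ≡ shift μ ν c → c ≈ c′

    ≈⇒vertex≡ : ∀ {c c′} → c ≈ c′ → vertex c ≡ vertex c′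
    ≈⇒vertex≡ {c} (shifted μ ν refl) = sym (vertex-shift μ ν c)

    swap-≈ : ∀ {c c′} → c ≈ c′ → swap c ≈ swap c′
    swap-≈ {c} (shifted μ ν refl) = shifted (+ 2 * ν * N - μ * Z) (ν * Z - μ * W) (swap-shift μ ν c)

    ≡⇒≈ : ∀ {c c′} → c′ ≡ c → c ≈ c′
    ≡⇒≈ {⟨ c , a , g ⟩} refl = shifted 0ℤ 0ℤ (cong₂ ⟨ c ,_,_⟩ (solve (a ∷ M ∷ [])) (solve (g ∷ M ∷ N ∷ Z ∷ [])))

    ≈-≡ : ∀ {c c′ c″} → c ≈ c′ → c′ ≡ c″ → c ≈ c″
    ≈-≡ c≈c′ refl = c≈c′

    ≈-diagonal : ∀ c a g t → ⟨ c , a , g ⟩ ≈ ⟨ c , a + t * (M * N) , g + t * (M * N) ⟩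
    ≈-diagonal c a g t = shifted (t * N) (t * (Y + 1ℤ)) (cong₂ ⟨ c ,_,_⟩ (solve (a ∷ t ∷ M ∷ N ∷ [])) (begin
      g + t * (M * N)
        ≡⟨ solve (g ∷ t ∷ M ∷ N ∷ Y ∷ []) ⟩
      g - t * N * M * (+ 2 * Y + 1ℤ) + t * (Y + 1ℤ) * (+ 2 * M * N)
        ≡⟨ cong (λ z → g - t * N * M * z + t * (Y + 1ℤ) * (+ 2 * M * N)) Z≡ ⟨
      g - t * N * M * Z + t * (Y + 1ℤ) * (+ 2 * M * N)
        ∎))

    ≈-period : ∀ c a g t → ⟨ c , a , g ⟩ ≈ ⟨ c , a , g + t * (+ 2 * M * N) ⟩
    ≈-period c a g t = shifted 0ℤ t (cong₂ ⟨ c ,_,_⟩ (solve (a ∷ M ∷ [])) (solve (g ∷ t ∷ M ∷ N ∷ Z ∷ [])))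

    row-next : Code → Code
    row-next ⟨ E0 , a , g ⟩ = ⟨ E1 , a , g ⟩
    row-next ⟨ E1 , a , g ⟩ = ⟨ E2 , a , g ⟩
    row-next ⟨ E2 , a , g ⟩ = ⟨ E3 , a , g ⟩
    row-next ⟨ E3 , a , g ⟩ = ⟨ E0 , a , g + 1ℤ ⟩
    row-next ⟨ O0 , a , g ⟩ = ⟨ O3 , a , g - 1ℤ ⟩
    row-next ⟨ O1 , a , g ⟩ = ⟨ O0 , a , g + (M * N + 1ℤ) ⟩
    row-next ⟨ O2 , a , g ⟩ = ⟨ O1 , a , g ⟩
    row-next ⟨ O3 , a , g ⟩ = ⟨ O2 , a , g + (M * N + 1ℤ) ⟩

    above : Fin 2 → Fin 2 → ℤ → ℤ → Code
    above zero       b a g = ⟨ (suc zero , zero , b) , a , g ⟩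
    above (suc zero) b a g = ⟨ (zero , suc zero , b) , a + 1ℤ , g ⟩

    data Step : Code → Code → Set where
      along : ∀ c → Step c (row-next c)
      up    : ∀ e b a g → Step ⟨ (e , e , b) , a , g ⟩ (above e b a g)

    swap-preserves-step : ∀ {c c′} → Step c c′ → ∃ λ d → Step (swap c) d × d ≈ swap c′
    swap-preserves-step (along ⟨ E0 , a , g ⟩) = _ , up zero zero _ _ , ≡⇒≈ refl
    swap-preserves-step (along ⟨ E1 , a , g ⟩) = _ , along _ , ≡⇒≈ refl
    swap-preserves-step (along ⟨ E2 , a , g ⟩) = _ , up (suc zero) (suc zero) _ _ , ≡⇒≈ refl
    swap-preserves-step (along ⟨ E3 , a , g ⟩) = _ , along _ , ≡⇒≈ (cong₂ ⟨ E0 ,_,_⟩ refl (solve (a ∷ [])))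
    swap-preserves-step (along ⟨ O0 , a , g ⟩) = _ , along _ , ≡⇒≈ (cong₂ ⟨ E2 ,_,_⟩ (solve (g ∷ [])) refl)
    swap-preserves-step (along ⟨ O1 , a , g ⟩) = _ , up (suc zero) zero _ _ ,
      ≈-≡ (≈-diagonal _ _ _ 1ℤ) (cong₂ ⟨ E1 ,_,_⟩ (solve (g ∷ M ∷ N ∷ [])) (solve (a ∷ M ∷ N ∷ [])))
    swap-preserves-step (along ⟨ O2 , a , g ⟩) = _ , along _ ,
      ≈-≡ (≈-period _ _ _ -1ℤ) (cong₂ ⟨ O1 ,_,_⟩ refl (solve (a ∷ M ∷ N ∷ [])))
    swap-preserves-step (along ⟨ O3 , a , g ⟩) = _ , up zero (suc zero) _ _ ,
      ≈-≡ (≈-diagonal _ _ _ 1ℤ) (cong₂ ⟨ O2 ,_,_⟩ (solve (g ∷ M ∷ N ∷ [])) (solve (a ∷ M ∷ N ∷ [])))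
    swap-preserves-step (up zero       zero       a g) = _ , along _ , ≡⇒≈ refl
    swap-preserves-step (up zero       (suc zero) a g) =
      _ , along _ , ≡⇒≈ (cong₂ ⟨ O2 ,_,_⟩ refl (solve (a ∷ M ∷ N ∷ [])))
    swap-preserves-step (up (suc zero) zero       a g) =
      _ , along _ , ≡⇒≈ (cong₂ ⟨ O0 ,_,_⟩ refl (solve (a ∷ M ∷ N ∷ [])))
    swap-preserves-step (up (suc zero) (suc zero) a g) = _ , along _ , ≡⇒≈ (cong₂ ⟨ E3 ,_,_⟩ refl (solve (a ∷ [])))

    swap-swap : ∀ c → swap (swap c) ≈ c
    swap-swap ⟨ E0 , a , g ⟩ = ≡⇒≈ refl
    swap-swap ⟨ E1 , a , g ⟩ = ≡⇒≈ refl
    swap-swap ⟨ E2 , a , g ⟩ = ≡⇒≈ (cong₂ ⟨ E2 ,_,_⟩ (solve (a ∷ [])) refl)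
    swap-swap ⟨ E3 , a , g ⟩ = ≡⇒≈ (cong₂ ⟨ E3 ,_,_⟩ (solve (a ∷ [])) (solve (g ∷ [])))
    swap-swap ⟨ O0 , a , g ⟩ = ≡⇒≈ refl
    swap-swap ⟨ O1 , a , g ⟩ =
      ≈-≡ (≈-diagonal _ _ _ 1ℤ) (cong₂ ⟨ O1 ,_,_⟩ (solve (a ∷ M ∷ N ∷ [])) (solve (g ∷ M ∷ N ∷ [])))
    swap-swap ⟨ O2 , a , g ⟩ =
      ≈-≡ (≈-diagonal _ _ _ -1ℤ) (cong₂ ⟨ O2 ,_,_⟩ (solve (a ∷ M ∷ N ∷ [])) (solve (g ∷ M ∷ N ∷ [])))
    swap-swap ⟨ O3 , a , g ⟩ = ≡⇒≈ (cong₂ ⟨ O3 ,_,_⟩ refl (solve (g ∷ [])))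

    column+ : ℤ → Point → Point
    column+ s ⟪ i , j ⟫ = ⟪ i , j + s ⟫

    row+1 : Point → Point
    row+1 ⟪ i , j ⟫ = ⟪ i + 1ℤ , j ⟫

    decode-row-next-even : ∀ f b a g → decode (row-next ⟨ (zero , f , b) , a , g ⟩)
                                 ≡ column+ 1ℤ (decode ⟨ (zero , f , b) , a , g ⟩)
    decode-row-next-even zero       zero       a g = cong₂ ⟪_,_⟫ refl (solve (a ∷ g ∷ M ∷ N ∷ []))
    decode-row-next-even (suc zero) zero       a g = cong₂ ⟪_,_⟫ refl (solve (a ∷ g ∷ M ∷ N ∷ []))
    decode-row-next-even zero       (suc zero) a g = cong₂ ⟪_,_⟫ refl (solve (a ∷ g ∷ M ∷ N ∷ []))
    decode-row-next-even (suc zero) (suc zero) a g = cong₂ ⟪_,_⟫ refl (solve (a ∷ g ∷ M ∷ N ∷ []))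

    decode-row-next-odd : ∀ f b a g → decode (row-next ⟨ (suc zero , f , b) , a , g ⟩)
                                ≡ column+ (+ 2 * M * N + 1ℤ) (decode ⟨ (suc zero , f , b) , a , g ⟩)
    decode-row-next-odd zero       zero       a g = cong₂ ⟪_,_⟫ refl (solve (a ∷ g ∷ M ∷ N ∷ []))
    decode-row-next-odd (suc zero) zero       a g = cong₂ ⟪_,_⟫ refl (solve (a ∷ g ∷ M ∷ N ∷ []))
    decode-row-next-odd zero       (suc zero) a g = cong₂ ⟪_,_⟫ refl (solve (a ∷ g ∷ M ∷ N ∷ []))
    decode-row-next-odd (suc zero) (suc zero) a g = cong₂ ⟪_,_⟫ refl (solve (a ∷ g ∷ M ∷ N ∷ []))

    decode-above : ∀ e b a g → decode (above e b a g) ≡ row+1 (decode ⟨ (e , e , b) , a , g ⟩)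
    decode-above zero       b a g = from-even ⟦ b ⟧
      where
      from-even : ∀ B → position 1ℤ 0ℤ B a g ≡ row+1 (position 0ℤ 0ℤ B a g)
      from-even B = cong₂ ⟪_,_⟫ (solve (a ∷ [])) (solve (B ∷ a ∷ g ∷ M ∷ N ∷ []))
    decode-above (suc zero) b a g = from-odd ⟦ b ⟧
      where
      from-odd : ∀ B → position 0ℤ 1ℤ B (a + 1ℤ) g ≡ row+1 (position 1ℤ 1ℤ B a g)
      from-odd B = cong₂ ⟪_,_⟫ (solve (a ∷ [])) (solve (B ∷ a ∷ g ∷ M ∷ N ∷ []))

    vertex-row-next : ∀ e f b a g → vertex (row-next ⟨ (e , f , b) , a , g ⟩)
                              ≡ project (column+ (+ stride e) (decode ⟨ (e , f , b) , a , g ⟩))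
    vertex-row-next zero       f b a g = cong project (decode-row-next-even f b a g)
    vertex-row-next (suc zero) f b a g = cong project (trans (decode-row-next-odd f b a g)
      (cong (λ s → column+ s (decode ⟨ (suc zero , f , b) , a , g ⟩)) (sym k≡)))

    row-parity-of : ∀ e a → (+ 2 * a + ⟦ e ⟧) %ℕ 2 ≡ toℕ e
    row-parity-of e a = proj₁ (divmod-exact (+ 2 * a + ⟦ e ⟧) 2 (toℕ e) a (toℕ<n e) (2a+x≡x+a*2 a ⟦ e ⟧))

    column-parity-of : ∀ e f b a g → column-of (decode ⟨ (e , f , b) , a , g ⟩) %ℕ 2 ≡ toℕ f
    column-parity-of e f b a g = proj₁ (divmod-exact (column-of (decode ⟨ (e , f , b) , a , g ⟩)) 2 (toℕ f)
      (+ 2 * g + ⟦ b ⟧ + (a + ⟦ e ⟧ * ⟦ f ⟧) * (M * N + 1ℤ)) (toℕ<n f) (column-parity-split ⟦ e ⟧ ⟦ f ⟧ ⟦ b ⟧ a g))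

    step⇒edge : ∀ {c c′} → Step c c′ → Edge m n k ℓ (vertex c) (vertex c′)
    step⇒edge (along ⟨ (e , f , b) , a , g ⟩) =
      subst (Edge m n k ℓ (vertex ⟨ (e , f , b) , a , g ⟩)) (sym (vertex-row-next e f b a g))
        (along-edge e (row-of p) (column-of p) (row-parity-of e a))
      where p = decode ⟨ (e , f , b) , a , g ⟩
    step⇒edge (up e b a g) =
      subst (Edge m n k ℓ (vertex ⟨ (e , e , b) , a , g ⟩)) (cong project (sym (decode-above e b a g)))
        (up-edge (row-of p) (column-of p) (trans (row-parity-of e a) (sym (column-parity-of e e b a g))))
      where p = decode ⟨ (e , e , b) , a , g ⟩

    -- block i j is the value of 2g + b at the point (i , j).
    block : ℕ → ℕ → ℤ
    block i j = + (j ℕ./ 2) - (+ (i ℕ./ 2) + + (i ℕ.% 2) * + (j ℕ.% 2)) * (M * N + 1ℤ)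

    encode : ℕ → ℕ → Code
    encode i j = ⟨ ((+ i) mod 2 , (+ j) mod 2 , block i j mod 2) , + (i ℕ./ 2) , block i j /ℕ 2 ⟩

    code-of : Vertex m n → Code
    code-of (i , j) = encode (toℕ i) (toℕ j)

    column-from-block : ∀ e f b a g J → b + g * + 2 ≡ J - (a + e * f) * (M * N + 1ℤ) →
                       + 4 * g + + 2 * b + f + (a + e * f) * (+ 2 * (M * N + 1ℤ)) ≡ f + J * + 2
    column-from-block e f b a g J eq = begin
      + 4 * g + + 2 * b + f + (a + e * f) * (+ 2 * (M * N + 1ℤ))
        ≡⟨ column-parity-split e f b a g ⟩
      f + (+ 2 * g + b + (a + e * f) * (M * N + 1ℤ)) * + 2
        ≡⟨ cong (λ x → f + (x + (a + e * f) * (M * N + 1ℤ)) * + 2) (trans (2a+x≡x+a*2 g b) eq) ⟩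
      f + (J - (a + e * f) * (M * N + 1ℤ) + (a + e * f) * (M * N + 1ℤ)) * + 2
        ≡⟨ solve (f ∷ J ∷ e ∷ a ∷ M ∷ N ∷ []) ⟩
      f + J * + 2
        ∎

    decode-encode : ∀ i j → decode (encode i j) ≡ ⟪ + i , + j ⟫
    decode-encode i j = cong₂ ⟪_,_⟫ row column
      where
      Q = block i j
      ⟦mod⟧ : ∀ x → ⟦ x mod 2 ⟧ ≡ + (x %ℕ 2)
      ⟦mod⟧ x = cong +_ (toℕ-mod x 2)
      row : + 2 * + (i ℕ./ 2) + ⟦ (+ i) mod 2 ⟧ ≡ + i
      row = begin
        + 2 * + (i ℕ./ 2) + ⟦ (+ i) mod 2 ⟧  ≡⟨ cong (_+_ (+ 2 * + (i ℕ./ 2))) (⟦mod⟧ (+ i)) ⟩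
        + 2 * + (i ℕ./ 2) + + (i ℕ.% 2)      ≡⟨ 2a+x≡x+a*2 (+ (i ℕ./ 2)) (+ (i ℕ.% 2)) ⟩
        + (i ℕ.% 2) + + (i ℕ./ 2) * + 2      ≡⟨ a≡a%ℕn+[a/ℕn]*n (+ i) 2 ⟨
        + i                                  ∎
      Q≡ : ⟦ Q mod 2 ⟧ + Q /ℕ 2 * + 2 ≡ + (j ℕ./ 2) - (+ (i ℕ./ 2) + ⟦ (+ i) mod 2 ⟧ * ⟦ (+ j) mod 2 ⟧) * (M * N + 1ℤ)
      Q≡ = begin
        ⟦ Q mod 2 ⟧ + Q /ℕ 2 * + 2
          ≡⟨ cong (_+ Q /ℕ 2 * + 2) (⟦mod⟧ Q) ⟩
        + (Q %ℕ 2) + Q /ℕ 2 * + 2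
          ≡⟨ a≡a%ℕn+[a/ℕn]*n Q 2 ⟨
        Q
          ≡⟨ cong₂ (λ e f → + (j ℕ./ 2) - (+ (i ℕ./ 2) + e * f) * (M * N + 1ℤ)) (⟦mod⟧ (+ i)) (⟦mod⟧ (+ j)) ⟨
        + (j ℕ./ 2) - (+ (i ℕ./ 2) + ⟦ (+ i) mod 2 ⟧ * ⟦ (+ j) mod 2 ⟧) * (M * N + 1ℤ)
          ∎
      column : + 4 * (Q /ℕ 2) + + 2 * ⟦ Q mod 2 ⟧ + ⟦ (+ j) mod 2 ⟧
               + (+ (i ℕ./ 2) + ⟦ (+ i) mod 2 ⟧ * ⟦ (+ j) mod 2 ⟧) * (+ 2 * (M * N + 1ℤ)) ≡ + j
      column = begin
        _ ≡⟨ column-from-block ⟦ (+ i) mod 2 ⟧ ⟦ (+ j) mod 2 ⟧ ⟦ Q mod 2 ⟧ (+ (i ℕ./ 2)) (Q /ℕ 2) (+ (j ℕ./ 2)) Q≡ ⟩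
        ⟦ (+ j) mod 2 ⟧ + + (j ℕ./ 2) * + 2  ≡⟨ cong (_+ + (j ℕ./ 2) * + 2) (⟦mod⟧ (+ j)) ⟩
        + (j ℕ.% 2) + + (j ℕ./ 2) * + 2      ≡⟨ a≡a%ℕn+[a/ℕn]*n (+ j) 2 ⟨
        + j                                  ∎

    vertex-code-of : ∀ u → vertex (code-of u) ≡ u
    vertex-code-of u = trans (cong project (decode-encode (toℕ (proj₁ u)) (toℕ (proj₂ u)))) (project-lift u)

    code-of-vertex : ∀ c → c ≈ code-of (vertex c)
    code-of-vertex c = shifted μ ν (decode-injective _ _ (begin
      decode (code-of (vertex c))      ≡⟨ decode-encode _ _ ⟩
      lift (vertex c)              ≡⟨ proj₂ (proj₂ (lift-project (decode c))) ⟩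
      translate μ ν (decode c)     ≡⟨ decode-shift μ ν c ⟨
      decode (shift μ ν c)         ∎))
      where
      μ = proj₁ (lift-project (decode c))
      ν = proj₁ (proj₂ (lift-project (decode c)))

    along-lifts : ∀ (i : Fin m) (j j′ : Fin n) e → toℕ i ℕ.% 2 ≡ toℕ e → toℕ j′ ≡ (toℕ j ℕ.+ stride e) [mod n ] →
                  vertex (row-next (code-of (i , j))) ≡ (i , j′)
    along-lifts i j j′ e i≡e j′≡ = begin
      vertex (row-next (code-of (i , j)))
        ≡⟨ vertex-row-next E _ _ _ _ ⟩
      project (column+ (+ stride E) (decode (code-of (i , j))))
        ≡⟨ cong₂ (λ s p → project (column+ (+ stride s) p)) E≡e (decode-encode (toℕ i) (toℕ j)) ⟩
      project ⟪ + toℕ i , + toℕ j + + stride e ⟫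
        ≡⟨ row-lift i j j′ (stride e) j′≡ ⟩
      (i , j′)
        ∎
      where
      E = (+ toℕ i) mod 2
      E≡e : E ≡ e
      E≡e = toℕ-injective (trans (toℕ-mod (+ toℕ i) 2) i≡e)

    up-lifts : ∀ (i : Fin m) (j : Fin n) v → toℕ j ℕ.% 2 ≡ toℕ i ℕ.% 2 → project ⟪ + toℕ i + 1ℤ , + toℕ j ⟫ ≡ v →
               ∃ λ c′ → Step (code-of (i , j)) c′ × vertex c′ ≡ v
    up-lifts i j v j≡i lands =
      above E B a g , subst (λ f → Step ⟨ (E , f , B) , a , g ⟩ (above E B a g)) (sym F≡E) (up E B a g) , (begin
        vertex (above E B a g)
          ≡⟨ cong project (decode-above E B a g) ⟩
        project (row+1 (decode ⟨ (E , E , B) , a , g ⟩))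
          ≡⟨ cong (λ f → project (row+1 (decode ⟨ (E , f , B) , a , g ⟩))) F≡E ⟨
        project (row+1 (decode (code-of (i , j))))
          ≡⟨ cong (λ p → project (row+1 p)) (decode-encode (toℕ i) (toℕ j)) ⟩
        project ⟪ + toℕ i + 1ℤ , + toℕ j ⟫
          ≡⟨ lands ⟩
        v
          ∎)
      where
      E = (+ toℕ i) mod 2
      F = (+ toℕ j) mod 2
      B = block (toℕ i) (toℕ j) mod 2
      a = + (toℕ i ℕ./ 2)
      g = block (toℕ i) (toℕ j) /ℕ 2
      F≡E : F ≡ E
      F≡E = toℕ-injective (trans (toℕ-mod (+ toℕ j) 2) (trans j≡i (sym (toℕ-mod (+ toℕ i) 2))))

    edge⇒step : ∀ {u v} → Edge m n k ℓ u v → ∃ λ c′ → Step (code-of u) c′ × vertex c′ ≡ v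
    edge⇒step (rowEven i j j′ i-even j′≡) = _ , along _ , along-lifts i j j′ zero i-even j′≡
    edge⇒step (rowOdd i j j′ i-odd j′≡)   = _ , along _ , along-lifts i j j′ (suc zero) i-odd j′≡
    edge⇒step (vert i i′ j i′≡ j≡i)       = up-lifts i j (i′ , j) j≡i (vert-lift i i′ j i′≡)
    edge⇒step (wrap i i′ j j′ last first j-odd j′≡) =
      up-lifts i j (i′ , j′) (trans j-odd (sym (last-row-odd (toℕ i) last))) (wrap-lift i i′ j j′ last first j′≡)

    φ : Vertex m n → Vertex m n
    φ u = vertex (swap (code-of u))

    swap-respects-vertex : ∀ c → vertex (swap (code-of (vertex c))) ≡ vertex (swap c)
    swap-respects-vertex c = sym (≈⇒vertex≡ (swap-≈ (code-of-vertex c)))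

    φ-involutive : ∀ u → φ (φ u) ≡ u
    φ-involutive u = begin
      vertex (swap (code-of (vertex (swap (code-of u)))))  ≡⟨ swap-respects-vertex (swap (code-of u)) ⟩
      vertex (swap (swap (code-of u)))                ≡⟨ ≈⇒vertex≡ (swap-swap (code-of u)) ⟩
      vertex (code-of u)                              ≡⟨ vertex-code-of u ⟩
      u                                           ∎

    φ-edge : ∀ {u v} → Edge m n k ℓ u v → Edge m n k ℓ (φ u) (φ v)
    φ-edge {u} {v} uv with edge⇒step uv
    ... | c′ , s , c′↦v with swap-preserves-step s
    ... | d , s′ , d≈ = subst (Edge m n k ℓ (φ u)) (begin
      vertex d                         ≡⟨ ≈⇒vertex≡ d≈ ⟩
      vertex (swap c′)                 ≡⟨ swap-respects-vertex c′ ⟨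
      vertex (swap (code-of (vertex c′)))  ≡⟨ cong φ c′↦v ⟩
      φ v                              ∎) (step⇒edge s′)

    automorphism : Automorphism m n k ℓ
    automorphism = involution⇒automorphism φ φ-involutive (λ _ _ uv → inj₁ (φ-edge uv))

    vertex-of-lift : ∀ {c u} → decode c ≡ lift u → vertex c ≡ u
    vertex-of-lift {u = u} eq = trans (cong project eq) (project-lift u)

    φ-computed-by : ∀ c {u u′} → decode c ≡ lift u → decode (swap c) ≡ lift u′ → φ u ≡ u′
    φ-computed-by c {u} {u′} c↦u swap-c↦u′ = begin
      φ u               ≡⟨ cong φ (vertex-of-lift c↦u) ⟨
      φ (vertex c)      ≡⟨ swap-respects-vertex c ⟩
      vertex (swap c)   ≡⟨ vertex-of-lift swap-c↦u′ ⟩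
      u′                ∎

    φ-fixes-origin : ∀ u → lift u ≡ ⟪ 0ℤ , 0ℤ ⟫ → φ u ≡ u
    φ-fixes-origin u u≡ = φ-computed-by ⟨ E0 , 0ℤ , 0ℤ ⟩ (sym u≡) (sym u≡)

    φ-exchanges : ∀ v w → lift v ≡ ⟪ 0ℤ , 1ℤ ⟫ → lift w ≡ ⟪ 1ℤ , 0ℤ ⟫ → φ v ≡ w × φ w ≡ v
    φ-exchanges v w v≡ w≡ =
      φ-computed-by ⟨ E1 , 0ℤ , 0ℤ ⟩ (sym v≡) (sym w≡) , φ-computed-by ⟨ O0 , 0ℤ , 0ℤ ⟩ (sym w≡) (sym v≡)

  module _ (m₀ n₀ ℓ₀ y w : ℕ) .{{_ : ℕ.NonZero (2 ℕ.* m₀)}} .{{_ : ℕ.NonZero (8 ℕ.* m₀ ℕ.* n₀)}}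
           (ℓ₀≡ : m₀ ℕ.* n₀ ℕ.+ ℓ₀ ≡ 1 ℕ.+ 4 ℕ.* y) (w≡ : 2 ℕ.* y ℕ.* (y ℕ.+ 1) ≡ w ℕ.* n₀) where

    private
      pos-*-+ : ∀ a b c → + (a ℕ.* b ℕ.+ c) ≡ + a * + b + + c
      pos-*-+ a b c = trans (pos-+ (a ℕ.* b) c) (cong (_+ + c) (pos-* a b))

      pos-*-* : ∀ a b c → + (a ℕ.* b ℕ.* c) ≡ + a * + b * + c
      pos-*-* a b c = trans (pos-* (a ℕ.* b) c) (cong (_* + c) (pos-* a b))

      ℓ₀-from : ∀ P L Y → P + L ≡ 1ℤ + + 4 * Y → L ≡ + 2 * (+ 2 * Y + 1ℤ) - P - 1ℤ
      ℓ₀-from P L Y eq = begin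
        L                          ≡⟨ solve (P ∷ L ∷ []) ⟩
        P + L - P                  ≡⟨ cong (_- P) eq ⟩
        1ℤ + + 4 * Y - P           ≡⟨ solve (P ∷ Y ∷ []) ⟩
        + 2 * (+ 2 * Y + 1ℤ) - P - 1ℤ ∎

      odd-square : ∀ Y N W → + 2 * Y * (Y + 1ℤ) ≡ W * N → (+ 2 * Y + 1ℤ) * (+ 2 * Y + 1ℤ) ≡ 1ℤ + + 2 * N * W
      odd-square Y N W eq = begin
        (+ 2 * Y + 1ℤ) * (+ 2 * Y + 1ℤ)  ≡⟨ solve (Y ∷ []) ⟩
        1ℤ + + 2 * (+ 2 * Y * (Y + 1ℤ))  ≡⟨ cong (λ t → 1ℤ + + 2 * t) eq ⟩
        1ℤ + + 2 * (W * N)              ≡⟨ solve (N ∷ W ∷ []) ⟩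
        1ℤ + + 2 * N * W                ∎

      ℓ≡ : + (2 ℕ.* m₀ ℕ.* ℓ₀) ≡ + 2 * + m₀ * (+ 2 * (+ 2 * + y + 1ℤ) - + m₀ * + n₀ - 1ℤ)
      ℓ≡ = trans (pos-*-* 2 m₀ ℓ₀) (cong (λ L → + 2 * + m₀ * L) (ℓ₀-from (+ m₀ * + n₀) (+ ℓ₀) (+ y) (begin
        + m₀ * + n₀ + + ℓ₀    ≡⟨ pos-*-+ m₀ n₀ ℓ₀ ⟨
        + (m₀ ℕ.* n₀ ℕ.+ ℓ₀)  ≡⟨ cong +_ ℓ₀≡ ⟩
        + (1 ℕ.+ 4 ℕ.* y)     ≡⟨ trans (pos-+ 1 (4 ℕ.* y)) (cong (_+_ 1ℤ) (pos-* 4 y)) ⟩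
        1ℤ + + 4 * + y        ∎)))

      Z²≡ : (+ 2 * + y + 1ℤ) * (+ 2 * + y + 1ℤ) ≡ 1ℤ + + 2 * + n₀ * + w
      Z²≡ = odd-square (+ y) (+ n₀) (+ w) (begin
        + 2 * + y * (+ y + 1ℤ)       ≡⟨ trans (pos-* (2 ℕ.* y) (y ℕ.+ 1)) (cong₂ _*_ (pos-* 2 y) (pos-+ y 1)) ⟨
        + (2 ℕ.* y ℕ.* (y ℕ.+ 1))    ≡⟨ cong +_ w≡ ⟩
        + (w ℕ.* n₀)                 ≡⟨ pos-* w n₀ ⟩
        + w * + n₀                   ∎)

      open Swap (2 ℕ.* m₀) (8 ℕ.* m₀ ℕ.* n₀) (2 ℕ.* m₀ ℕ.* n₀ ℕ.+ 1) (2 ℕ.* m₀ ℕ.* ℓ₀)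
                (divides m₀ (ℕₚ.*-comm 2 m₀)) (∣-trans (divides 4 refl) (∣-trans (m∣m*n m₀) (m∣m*n n₀)))
                (∣-trans (m∣m*n m₀) (m∣m*n ℓ₀))
                (+ m₀) (+ n₀) (+ 2 * + y + 1ℤ) (+ y) (+ w)
                (pos-* 2 m₀) (pos-*-* 8 m₀ n₀) (trans (pos-+ (2 ℕ.* m₀ ℕ.* n₀) 1) (cong (_+ 1ℤ) (pos-*-* 2 m₀ n₀)))
                ℓ≡ refl Z²≡

    swap-automorphism : Σ (Automorphism (2 ℕ.* m₀) (8 ℕ.* m₀ ℕ.* n₀) (2 ℕ.* m₀ ℕ.* n₀ ℕ.+ 1) (2 ℕ.* m₀ ℕ.* ℓ₀))
                          FixesOriginSwapsNeighbours
    swap-automorphism = automorphism , λ u v w u₁ u₂ v₁ v₂ w₁ w₂ →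
      φ-fixes-origin u (lift≡ u₁ u₂) , φ-exchanges v w (lift≡ v₁ v₂) (lift≡ w₁ w₂)
      where
      lift≡ : ∀ {u : Vertex (2 ℕ.* m₀) (8 ℕ.* m₀ ℕ.* n₀)} {a b} →
              toℕ (proj₁ u) ≡ a → toℕ (proj₂ u) ≡ b → lift u ≡ ⟪ + a , + b ⟫
      lift≡ a≡ b≡ = cong₂ ⟪_,_⟫ (cong +_ a≡) (cong +_ b≡)

-- The divisibility hypothesis

open import Data.Nat using (_+_; _*_; _∸_; _≤_; _<_)
open import Data.Nat.Tactic.RingSolver using (solve)
open ≡-Reasoning

2-prime : Prime 2
2-prime = from-yes (prime? 2)

2∣x[x+2k]⇒2∣x : ∀ x k → 2 ∣ x * (x + 2 * k) → 2 ∣ x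
2∣x[x+2k]⇒2∣x x k 2∣x[x+2k] with euclidsLemma x (x + 2 * k) 2-prime 2∣x[x+2k]
... | inj₁ 2∣x      = 2∣x
... | inj₂ 2∣x+2k = ∣m+n∣m⇒∣n (subst (2 ∣_) (ℕₚ.+-comm x (2 * k)) 2∣x+2k) (divides k (ℕₚ.*-comm 2 k))

8n∣x[x+4]⇒x≡4y : ∀ n x → 8 * n ∣ x * (x + 4) → ∃ λ y → x ≡ 4 * y × n ∣ 2 * y * (y + 1)
8n∣x[x+4]⇒x≡4y n x 8n∣x[x+4] = halve (2∣x[x+2k]⇒2∣x x 2 (∣-trans (∣-trans (divides 4 refl) (m∣m*n n)) 8n∣x[x+4]))
  where
  regroup₁ : ∀ p → p * 2 * (p * 2 + 4) ≡ 4 * (p * (p + 2 * 1))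
  regroup₁ p = solve (p ∷ [])
  regroup₂ : ∀ y → y * 2 * (y * 2 + 2 * 1) ≡ 2 * (2 * y * (y + 1))
  regroup₂ y = solve (y ∷ [])
  regroup₃ : ∀ y → y * 2 * 2 ≡ 4 * y
  regroup₃ y = solve (y ∷ [])
  8n≡4[2n] : 8 * n ≡ 4 * (2 * n)
  8n≡4[2n] = solve (n ∷ [])
  quarter : ∀ p → x ≡ p * 2 → 2 * n ∣ p * (p + 2 * 1) → 2 ∣ p → ∃ λ y → x ≡ 4 * y × n ∣ 2 * y * (y + 1)
  quarter p x≡p*2 2n∣p[p+2] (divides y p≡y*2) =
    y , trans x≡p*2 (trans (cong (_* 2) p≡y*2) (regroup₃ y)) ,
    *-cancelˡ-∣ 2 (subst (2 * n ∣_) (trans (cong (λ p → p * (p + 2 * 1)) p≡y*2) (regroup₂ y)) 2n∣p[p+2])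
  halve : 2 ∣ x → ∃ λ y → x ≡ 4 * y × n ∣ 2 * y * (y + 1)
  halve (divides p x≡p*2) = quarter p x≡p*2 2n∣p[p+2] (2∣x[x+2k]⇒2∣x p 1 (∣-trans (m∣m*n n) 2n∣p[p+2]))
    where
    2n∣p[p+2] : 2 * n ∣ p * (p + 2 * 1)
    2n∣p[p+2] = *-cancelˡ-∣ 4 (subst₂ _∣_ 8n≡4[2n] (trans (cong (λ x → x * (x + 4)) x≡p*2) (regroup₁ p)) 8n∣x[x+4])

proposition7p11 : (m₀ n₀ ℓ₀ : ℕ) → 2 ≤ m₀ → 1 ≤ n₀ → ℓ₀ < 4 * n₀ →
    (8 * n₀) ∣ ((m₀ * n₀ + ℓ₀ ∸ 1) * (m₀ * n₀ + ℓ₀ + 3)) →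
    Σ (Automorphism (2 * m₀) (8 * m₀ * n₀) (2 * m₀ * n₀ + 1) (2 * m₀ * ℓ₀)) λ φ →
      (∀ (u v w : Vertex (2 * m₀) (8 * m₀ * n₀)) →
        toℕ (proj₁ u) ≡ 0 → toℕ (proj₂ u) ≡ 0 →
        toℕ (proj₁ v) ≡ 0 → toℕ (proj₂ v) ≡ 1 →
        toℕ (proj₁ w) ≡ 1 → toℕ (proj₂ w) ≡ 0 →
        (Automorphism.to φ u ≡ u) × (Automorphism.to φ v ≡ w) × (Automorphism.to φ w ≡ v))
proposition7p11 m₀@(ℕ.suc _) n₀@(ℕ.suc _) ℓ₀ _ _ _ 8n₀∣x[x+4] =
  let y , x≡4y , divides w w≡ = 8n∣x[x+4]⇒x≡4y n₀ x (subst (λ t → 8 * n₀ ∣ x * t) (sym (ℕₚ.+-suc x 3)) 8n₀∣x[x+4])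
  in swap-automorphism m₀ n₀ ℓ₀ y w (cong ℕ.suc x≡4y) w≡
  where
  x = m₀ * n₀ + ℓ₀ ∸ 1
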